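{- A minimal weak link $(G,s,t)$ has at most one articulation vertex (cut-vertex) in $G$.
   Context: A Shannon game (link) $(G,s,t)$ consists of a finite simple graph $G$ and two distinct designated vertices $s,t$, the terminals. Two players, Short and Cut, alternately select a not-yet-selected non-terminal vertex; Short claims his vertices, Cut deletes his. Short wins if at the end there is an $s$–$t$ path all of whose internal vertices are claimed by Short; otherwise Cut wins. The link is strong if Short has a winning strategy when moving second, and weak if Short has a winning strategy when moving first but not when moving second. A weak link is minimal if deleting any single edge of $G$ produces a game in which Short has no winning strategy as first player. -}

module Defs where

open import Level using (0ℓ)
open import Data.Nat using (ℕ)
open import Data.Unit using (⊤)
open import Relation.Nullary using (yes; no)
open import Data.Fin using (_≟_)
open import Data.Fin using (Fin)
open import Data.Product using (_×_; Σ; ∃; ∃-syntax; _,_)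
open import Data.Sum using (_⊎_; inj₁; inj₂)
open import Relation.Nullary using (¬_)
open import Relation.Binary.PropositionalEquality using (_≡_; _≢_)

record SimpleGraph (n : ℕ) : Set₁ where
  field
    Adj    : Fin n → Fin n → Set
    adj-sym    : ∀ {x y} → Adj x y → Adj y x
    adj-irrefl : ∀ {x} → ¬ Adj x x
open SimpleGraph public

deleteEdge : ∀ {n} → SimpleGraph n → Fin n → Fin n → SimpleGraph n
deleteEdge G u v = record
  { Adj    = λ x y → Adj G x y × ¬ (x ≡ u × y ≡ v) × ¬ (x ≡ v × y ≡ u)
  ; adj-sym    = λ { (a , p , q) → SimpleGraph.adj-sym G a
                 , (λ { (e1 , e2) → q (e2 , e1) })
                 , (λ { (e1 , e2) → p (e2 , e1) }) }
  ; adj-irrefl = λ { (a , _ , _) → SimpleGraph.adj-irrefl G a }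
  }

data WalkIn {n} (G : SimpleGraph n) (P : Fin n → Set) : Fin n → Fin n → Set where
  here : ∀ {a} → P a → WalkIn G P a a
  step : ∀ {a b c} → P a → Adj G a b → WalkIn G P b c → WalkIn G P a c

Connected : ∀ {n} → SimpleGraph n → Fin n → Fin n → Set
Connected G a b = WalkIn G (λ _ → ⊤) a b

ConnectedAvoiding : ∀ {n} → SimpleGraph n → Fin n → Fin n → Fin n → Set
ConnectedAvoiding G v a b = WalkIn G (λ x → x ≢ v) a b

-- v is an articulation vertex (cut-vertex): deleting v increases the
-- number of connected components, i.e. some two vertices other than v
-- are connected in G but not in G - v.
Articulation : ∀ {n} → SimpleGraph n → Fin n → Set
Articulation G v = ∃[ a ] ∃[ b ] (a ≢ v × b ≢ v × Connected G a b × ¬ ConnectedAvoiding G v a b)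

data Mark : Set where
  free claimed deleted : Mark

data Player : Set where
  short cut : Player

Position : ℕ → Set
Position n = Fin n → Mark

initial : ∀ {n} → Position n
initial _ = free

set : ∀ {n} → Position n → Fin n → Mark → Position n
set {n} p v m x with x ≟ v
... | yes _ = m
... | no _ = p x

module Game {n : ℕ} (G : SimpleGraph n) (s t : Fin n) where

  Selectable : Position n → Fin n → Set
  Selectable p v = v ≢ s × v ≢ t × p v ≡ free

  Full : Position n → Set
  Full p = ∀ v → v ≢ s → v ≢ t → p v ≢ free

  -- there is an s–t walk (hence path) whose internal vertices are all
  -- claimed by Short: walk from s to t in which every vertex except the
  -- last is s or claimed by Short
  ShortWalk : Position n → Fin n → Set
  ShortWalk p a = WalkIn G (λ x → x ≡ s ⊎ p x ≡ claimed ⊎ x ≡ t) a t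

  data ShortWinsFrom : Player → Position n → Set where
    finished : ∀ {pl p} → Full p → ShortWalk p s → ShortWinsFrom pl p
    shortMove : ∀ {p} v → Selectable p v →
                ShortWinsFrom cut (set p v claimed) → ShortWinsFrom short p
    cutMove : ∀ {p} → ¬ Full p →
              (∀ v → Selectable p v → ShortWinsFrom short (set p v deleted)) →
              ShortWinsFrom cut p

  ShortWinsFirst : Set
  ShortWinsFirst = ShortWinsFrom short initial

  ShortWinsSecond : Set
  ShortWinsSecond = ShortWinsFrom cut initial

open Game public

WeakLink : ∀ {n} → SimpleGraph n → Fin n → Fin n → Set
WeakLink G s t = ShortWinsFirst G s t × ¬ ShortWinsSecond G s t

MinimalWeakLink : ∀ {n} → SimpleGraph n → Fin n → Fin n → Set
MinimalWeakLink G s t =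
  WeakLink G s t × (∀ u v → Adj G u v → ¬ ShortWinsFirst (deleteEdge G u v) s t)

-- An articulation vertex v of a minimal weak link separates s from t: otherwise
-- some component of G - v avoids both terminals, and deleting an edge from v into
-- that component leaves every s–t walk available (shortcut it at its first and
-- last visit of v), so Short would still win first in a smaller graph. Two
-- distinct s–t separators v and w defeat Short as first player: whichever one
-- Short does not take, Cut deletes, and no s–t path survives.
module Submission where

open import Defs
open import Data.Nat using (ℕ)
open import Data.Fin using (Fin; _≟_)
open import Data.Fin.Properties using (any?)
open import Data.Product using (_×_; ∃-syntax; _,_; proj₁; proj₂)
open import Data.Sum using (_⊎_; inj₁; inj₂)
import Data.Sum as Sum
open import Data.Empty using (⊥; ⊥-elim)
open import Function using (_∘_)
open import Relation.Nullary using (¬_; Dec; yes; no)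
open import Relation.Unary using (Decidable)
open import Relation.Binary.PropositionalEquality using (_≡_; _≢_; refl; sym; trans; subst)

module _ {n : ℕ} {G : SimpleGraph n} {P : Fin n → Set} where

  _++_ : ∀ {a b c} → WalkIn G P a b → WalkIn G P b c → WalkIn G P a c
  here _     ++ w = w
  step p e r ++ w = step p e (r ++ w)

  snoc : ∀ {a b c} → WalkIn G P a b → Adj G b c → P c → WalkIn G P a c
  snoc (here p)     e pc = step p e (here pc)
  snoc (step p e r) f pc = step p e (snoc r f pc)

  reverse : ∀ {a b} → WalkIn G P a b → WalkIn G P b a
  reverse (here p)     = here p
  reverse (step p e r) = snoc (reverse r) (adj-sym G e) p

  P-at-target : ∀ {a b} → WalkIn G P a b → P b
  P-at-target (here p)     = p
  P-at-target (step _ _ r) = P-at-target r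

  map : ∀ {Q : Fin n → Set} → (∀ {x} → P x → Q x) → ∀ {a b} → WalkIn G P a b → WalkIn G Q a b
  map f (here p)     = here (f p)
  map f (step p e r) = step (f p) e (map f r)

module _ {n : ℕ} (G : SimpleGraph n) (v a : Fin n) where

  private
    Component : Fin n → Set
    Component = ConnectedAvoiding G v a

  ¬component-step : ∀ {x z} → ¬ Component x → x ≢ v → Adj G x z → ¬ Component z
  ¬component-step x∉ x≢v x~z a⇝z = x∉ (snoc a⇝z (adj-sym G x~z) x≢v)

  ∃-neighbour-in-component : ∀ {x y} → Component x → Connected G x y → ¬ Component y →
    ∃[ c ] Adj G v c × Component c
  ∃-neighbour-in-component x∈ (here _) y∉ = ⊥-elim (y∉ x∈)
  ∃-neighbour-in-component {x} x∈ (step {b = z} _ x~z r) y∉ with z ≟ v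
  ... | yes refl = x , adj-sym G x~z , x∈
  ... | no z≢v   = ∃-neighbour-in-component (snoc x∈ x~z z≢v) r y∉

  module _ {c : Fin n} (c∈ : Component c) {P : Fin n → Set} where

    private
      G' : SimpleGraph n
      G' = deleteEdge G v c

    kept-edge : ∀ {x z} → ¬ Component x → x ≢ v → Adj G x z → Adj G' x z
    kept-edge x∉ x≢v x~z = x~z , (λ (x≡v , _) → x≢v x≡v) , (λ (x≡c , _) → x∉ (subst Component (sym x≡c) c∈))

    walk-until-v : ∀ {x y} → ¬ Component x → WalkIn G P x y → WalkIn G' P x y ⊎ WalkIn G' P x v
    walk-until-v x∉ (here p) = inj₁ (here p)
    walk-until-v {x} x∉ (step p x~z r) with x ≟ v
    ... | yes refl = inj₂ (here p)
    ... | no x≢v   = Sum.map (step p e) (step p e) (walk-until-v (¬component-step x∉ x≢v x~z) r)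
      where e = kept-edge x∉ x≢v x~z

    walk-from-v : ∀ {x y} → ¬ Component y → WalkIn G P x y → WalkIn G' P x y ⊎ WalkIn G' P v y
    walk-from-v y∉ w = Sum.map reverse reverse (walk-until-v y∉ (reverse w))

    walk-deleteEdge : ∀ {x y} → ¬ Component x → ¬ Component y → WalkIn G P x y → WalkIn G' P x y
    walk-deleteEdge x∉ y∉ w with walk-until-v x∉ w | walk-from-v y∉ w
    ... | inj₁ x⇝y | _        = x⇝y
    ... | inj₂ _   | inj₁ x⇝y = x⇝y
    ... | inj₂ x⇝v | inj₂ v⇝y = x⇝v ++ v⇝y

terminals-linked : ∀ {n} {G : SimpleGraph n} {s t v x y : Fin n} →
  s ≡ v ⊎ t ≡ v ⊎ ConnectedAvoiding G v s t →
  ConnectedAvoiding G v x s → ConnectedAvoiding G v y t → ConnectedAvoiding G v s t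
terminals-linked (inj₁ refl)        x⇝s _   = ⊥-elim (P-at-target x⇝s refl)
terminals-linked (inj₂ (inj₁ refl)) _   y⇝t = ⊥-elim (P-at-target y⇝t refl)
terminals-linked (inj₂ (inj₂ s⇝t))  _   _   = s⇝t

linked-through-terminals : ∀ {n} {G : SimpleGraph n} {s t v x y : Fin n} →
  s ≡ v ⊎ t ≡ v ⊎ ConnectedAvoiding G v s t →
  ConnectedAvoiding G v x s ⊎ ConnectedAvoiding G v x t →
  ConnectedAvoiding G v y s ⊎ ConnectedAvoiding G v y t → ConnectedAvoiding G v x y
linked-through-terminals _   (inj₁ x⇝s) (inj₁ y⇝s) = x⇝s ++ reverse y⇝s
linked-through-terminals _   (inj₂ x⇝t) (inj₂ y⇝t) = x⇝t ++ reverse y⇝t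
linked-through-terminals bad (inj₁ x⇝s) (inj₂ y⇝t) = x⇝s ++ (terminals-linked bad x⇝s y⇝t ++ reverse y⇝t)
linked-through-terminals bad (inj₂ x⇝t) (inj₁ y⇝s) =
  x⇝t ++ (reverse (terminals-linked bad y⇝s x⇝t) ++ reverse y⇝s)

ShortWinsFrom-mono : ∀ {n} {G G' : SimpleGraph n} {s t : Fin n} →
  (∀ p → ShortWalk G s t p s → ShortWalk G' s t p s) →
  ∀ {pl p} → ShortWinsFrom G s t pl p → ShortWinsFrom G' s t pl p
ShortWinsFrom-mono f (finished full w) = finished full (f _ w)
ShortWinsFrom-mono f (shortMove v sel r) = shortMove v sel (ShortWinsFrom-mono f r)
ShortWinsFrom-mono f (cutMove ¬full g) = cutMove ¬full (λ v sel → ShortWinsFrom-mono f (g v sel))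

Separates : ∀ {n} → SimpleGraph n → Fin n → Fin n → Fin n → Set
Separates G s t v = v ≢ s × v ≢ t × ¬ ConnectedAvoiding G v s t

module _ {n : ℕ} {G : SimpleGraph n} {s t : Fin n} (mwl : MinimalWeakLink G s t) where

  minimal⇒component-meets-terminal : ∀ {v a b} → a ≢ v → Connected G a b → ¬ ConnectedAvoiding G v a b →
    ¬ ¬ (ConnectedAvoiding G v a s ⊎ ConnectedAvoiding G v a t)
  minimal⇒component-meets-terminal {v} {a} a≢v a~b a≁b ¬meets
    with (c , v~c , c∈) ← ∃-neighbour-in-component G v a (here a≢v) a~b a≁b =
    let ((first-win , _) , minimal) = mwl in
    minimal v c v~c (ShortWinsFrom-mono (λ _ → walk-deleteEdge G v a c∈ (¬meets ∘ inj₁) (¬meets ∘ inj₂))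
                                        first-win)

  articulation⇒separates : ∀ {v} → Articulation G v → Separates G s t v
  articulation⇒separates {v} (a , b , a≢v , b≢v , a~b , a≁b) =
    (λ v≡s → unseparated (inj₁ (sym v≡s))) ,
    (λ v≡t → unseparated (inj₂ (inj₁ (sym v≡t)))) ,
    (unseparated ∘ inj₂ ∘ inj₂)
    where
    unseparated : s ≡ v ⊎ t ≡ v ⊎ ConnectedAvoiding G v s t → ⊥
    unseparated bad =
      minimal⇒component-meets-terminal a≢v a~b a≁b λ a-meets →
      minimal⇒component-meets-terminal b≢v (reverse a~b) (a≁b ∘ reverse) λ b-meets →
      a≁b (linked-through-terminals bad a-meets b-meets)

set-≡ : ∀ {n} (p : Position n) (x : Fin n) (m : Mark) → set p x m x ≡ m
set-≡ p x m with x ≟ x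
... | yes _   = refl
... | no x≢x = ⊥-elim (x≢x refl)

set-≢ : ∀ {n} (p : Position n) {x u : Fin n} (m : Mark) → u ≢ x → set p x m u ≡ p u
set-≢ p {x} {u} m u≢x with u ≟ x
... | yes u≡x = ⊥-elim (u≢x u≡x)
... | no _    = refl

free? : (m : Mark) → Dec (m ≡ free)
free? free    = yes refl
free? claimed = no λ ()
free? deleted = no λ ()

selectable? : ∀ {n} (G : SimpleGraph n) (s t : Fin n) (p : Position n) → Decidable (Selectable G s t p)
selectable? G s t p v with v ≟ s | v ≟ t | free? (p v)
... | yes v≡s | _       | _        = no λ (v≢s , _) → v≢s v≡s
... | no _    | yes v≡t | _        = no λ (_ , v≢t , _) → v≢t v≡t
... | no _    | no _    | no pv≢free = no λ (_ , _ , pv≡free) → pv≢free pv≡free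
... | no v≢s  | no v≢t  | yes pv≡free = yes (v≢s , v≢t , pv≡free)

module _ {n : ℕ} {G : SimpleGraph n} {s t u : Fin n} (sep : Separates G s t u) where

  private
    free≢deleted : ∀ {m : Mark} → m ≡ free → m ≢ deleted
    free≢deleted refl ()

    u≢s : u ≢ s
    u≢s = proj₁ sep

    u≢t : u ≢ t
    u≢t = proj₁ (proj₂ sep)

  deleted-separator⇒¬ShortWins : ∀ {pl p} → p u ≡ deleted → ¬ ShortWinsFrom G s t pl p
  deleted-separator⇒¬ShortWins {p = p} pu≡deleted (finished _ s⇝t) =
    proj₂ (proj₂ sep) (map avoids-u s⇝t)
    where
    avoids-u : ∀ {x} → x ≡ s ⊎ p x ≡ claimed ⊎ x ≡ t → x ≢ u
    avoids-u (inj₁ x≡s)          refl = u≢s x≡s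
    avoids-u (inj₂ (inj₁ px≡claimed)) refl with trans (sym pu≡deleted) px≡claimed
    ... | ()
    avoids-u (inj₂ (inj₂ x≡t))   refl = u≢t x≡t
  deleted-separator⇒¬ShortWins {p = p} pu≡deleted (shortMove x (_ , _ , px≡free) r) =
    deleted-separator⇒¬ShortWins (trans (set-≢ p claimed u≢x) pu≡deleted) r
    where
    u≢x : u ≢ x
    u≢x refl = free≢deleted px≡free pu≡deleted
  -- Any legal move of Cut will do; one exists because p is not full.
  deleted-separator⇒¬ShortWins {p = p} pu≡deleted (cutMove ¬full g) with any? (selectable? G s t p)
  ... | no ¬sel = ¬full λ x x≢s x≢t px≡free → ¬sel (x , x≢s , x≢t , px≡free)
  ... | yes (x , sel@(_ , _ , px≡free)) =
    deleted-separator⇒¬ShortWins (trans (set-≢ p deleted u≢x) pu≡deleted) (g x sel)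
    where
    u≢x : u ≢ x
    u≢x refl = free≢deleted px≡free pu≡deleted

  free-separator⇒¬ShortWins-second : ∀ {p} → p u ≡ free → ¬ ShortWinsFrom G s t cut p
  free-separator⇒¬ShortWins-second pu≡free (finished full _) =
    full u u≢s u≢t pu≡free
  free-separator⇒¬ShortWins-second {p} pu≡free (cutMove _ g) =
    deleted-separator⇒¬ShortWins (set-≡ p u deleted) (g u (u≢s , u≢t , pu≡free))

two-free-separators⇒¬ShortWins-first : ∀ {n} {G : SimpleGraph n} {s t v w : Fin n} {p : Position n} →
  v ≢ w → Separates G s t v → Separates G s t w → p v ≡ free → p w ≡ free →
  ¬ ShortWinsFrom G s t short p
two-free-separators⇒¬ShortWins-first v≢w (v≢s , v≢t , _) _ pv≡free _ (finished full _) =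
  full _ v≢s v≢t pv≡free
two-free-separators⇒¬ShortWins-first {v = v} {w} {p} v≢w sep-v sep-w pv≡free pw≡free (shortMove x _ r)
  with x ≟ v
... | yes refl = free-separator⇒¬ShortWins-second sep-w (trans (set-≢ p claimed (v≢w ∘ sym)) pw≡free) r
... | no x≢v   = free-separator⇒¬ShortWins-second sep-v (trans (set-≢ p claimed (x≢v ∘ sym)) pv≡free) r

theorem4 : ∀ {n} (G : SimpleGraph n) (s t : Fin n) → s ≢ t →
    MinimalWeakLink G s t →
    ∀ v w → Articulation G v → Articulation G w → v ≡ w
theorem4 G s t _ mwl v w art-v art-w with v ≟ w
... | yes v≡w = v≡w
... | no v≢w  = ⊥-elim (two-free-separators⇒¬ShortWins-first v≢w
                          (articulation⇒separates mwl art-v) (articulation⇒separates mwl art-w)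
                          refl refl (proj₁ (proj₁ mwl)))
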